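{- For every positive integer $n$, $$p_{\mathcal O}(n)=(\text{number of odd positive divisors of } n)+p_{\mathcal F_0}(n)+p_{\mathcal F_1}(n).$$ That is, the number of partitions of $n$ with only odd parts equals the number of odd divisors of $n$, plus the number of partitions of $n$ (of dimension $\ge2$) whose parts are all odd except the smallest, which is even, and with the multiplicity of the largest part strictly greater than that of the smallest part, plus the number of partitions of $n$ (of dimension $\ge2$) whose parts are all odd except the largest, which is even, and with the multiplicity of the largest part strictly smaller than that of the smallest part.
   Context: A partition is written $(\lambda_1,\dots,\lambda_m)\times[k_1,\dots,k_m]$, where $m\ge1$, the parts $\lambda_i$ are integers with $\lambda_1>\dots>\lambda_m>0$ and the multiplicities $k_i$ are positive integers; its size is $\sum k_i\lambda_i$. For a set $S$ of partitions, $p_S(n)$ is the number of elements of $S$ of size $n$. $\mathcal O$ is the set of partitions all of whose parts $\lambda_i$ are odd. Among partitions of dimension $m\ge2$: $\mathcal F_0$ is the set with $\lambda_m$ even, $\lambda_i$ odd for $i<m$, and $k_1>k_m$; $\mathcal F_1$ is the set with $\lambda_1$ even, $\lambda_i$ odd for $i>1$, and $k_1<k_m$. -}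

module Defs where

open import Data.Nat using (ℕ; zero; suc; _+_; _*_; _<_; _>_; _≤_)
open import Data.Nat.Divisibility using (_∣_)
open import Data.Product using (_×_; _,_; ∃-syntax)
open import Data.List using (List; []; _∷_; length)
open import Data.List.Membership.Propositional using (_∈_)
open import Data.List.Relation.Unary.Unique.Propositional using (Unique)
open import Data.Unit using (⊤)
open import Data.Empty using (⊥)
open import Data.List using (_++_)
open import Function.Bundles using (_⇔_)
open import Relation.Binary.PropositionalEquality using (_≡_)

-- A partition (λ₁,…,λₘ)×[k₁,…,kₘ] is represented as the list
-- (λ₁ , k₁) ∷ … ∷ (λₘ , kₘ) ∷ [] of (part , multiplicity) pairs.
Pair : Set
Pair = ℕ × ℕ

Even Odd : ℕ → Set
Even n = 2 ∣ n
Odd n = 2 ∣ suc n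

Decreasing : List Pair → Set
Decreasing [] = ⊤
Decreasing (_ ∷ []) = ⊤
Decreasing ((a , _) ∷ (b , k) ∷ xs) = (a > b) × Decreasing ((b , k) ∷ xs)

AllPosMult : List Pair → Set
AllPosMult [] = ⊤
AllPosMult ((a , k) ∷ xs) = (0 < a) × (0 < k) × AllPosMult xs

IsPartition : List Pair → Set
IsPartition [] = ⊥
IsPartition xs@(_ ∷ _) = Decreasing xs × AllPosMult xs

size : List Pair → ℕ
size [] = 0
size ((a , k) ∷ xs) = k * a + size xs

AllOddParts : List Pair → Set
AllOddParts [] = ⊤
AllOddParts ((a , _) ∷ xs) = Odd a × AllOddParts xs

InO : List Pair → Set
InO xs = IsPartition xs × AllOddParts xs

InF0 : List Pair → Set
InF0 xs = IsPartition xs ×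
  ∃[ l₁ ] ∃[ k₁ ] ∃[ mid ] ∃[ lm ] ∃[ km ]
    ((xs ≡ (l₁ , k₁) ∷ mid ++ (lm , km) ∷ [])
     × Odd l₁ × AllOddParts mid × Even lm × (k₁ > km))

InF1 : List Pair → Set
InF1 xs = IsPartition xs ×
  ∃[ l₁ ] ∃[ k₁ ] ∃[ mid ] ∃[ lm ] ∃[ km ]
    ((xs ≡ (l₁ , k₁) ∷ mid ++ (lm , km) ∷ [])
     × Even l₁ × AllOddParts mid × Odd lm × (k₁ < km))

-- L lists, without repetition, exactly the elements of S of size n;
-- then p_S(n) = length L.
Enumerates : (List Pair → Set) → ℕ → List (List Pair) → Set
Enumerates S n L = Unique L × (∀ xs → xs ∈ L ⇔ (S xs × size xs ≡ n))

EnumeratesOddDivisors : ℕ → List ℕ → Set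
EnumeratesOddDivisors n L = Unique L × (∀ d → d ∈ L ⇔ (0 < d × d ∣ n × Odd d))

{-# OPTIONS --safe #-}
module Submission where

-- An odd partition with a single part is d^(n/d) for an odd divisor d of n.  In an odd
-- partition (λ₁,k₁) … (λₘ,kₘ) with m ≥ 2 the sum λ₂ + λₘ is even, so λ₁ < λ₂ + λₘ or
-- λ₁ > λ₂ + λₘ.  In the first case splitting the k₁ copies of λ₁ into λ₂ and λ₁ − λ₂ gives
-- the 𝓕₀-partition (λ₂,k₂+k₁) … (λₘ,kₘ) (λ₁−λ₂,k₁); in the second, splitting them into
-- λ₁ − λₘ and λₘ gives the 𝓕₁-partition (λ₁−λₘ,k₁) (λ₂,k₂) … (λₘ,kₘ+k₁).  Conversely,
-- merging min(k₁,kₘ) copies of the largest part of an 𝓕₀- or 𝓕₁-partition with as many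
-- copies of its smallest part undoes the splitting.  So the odd partitions of n are in
-- bijection with the disjoint union of the odd divisors of n and the 𝓕₀- and 𝓕₁-partitions
-- of n, and duplicate-free listings of the two sides have the same length.

open import Defs
open import Data.Nat using (ℕ; zero; suc; _+_; _*_; _∸_; _<_; _≤_; _<?_)
open import Data.Nat.Properties
open import Data.Nat.Divisibility using (_∣_; divides; ∣m∣n⇒∣m+n; ∣m+n∣m⇒∣n; ∣1⇒≡1; ∣-refl)
open import Data.Nat.DivMod using (_/_; m*n/n≡m)
open import Data.Nat.Tactic.RingSolver using (solve-∀)
open import Data.List using (List; []; _∷_; _++_; _∷ʳ_; map; length)
open import Data.List.Properties using (length-++; length-map; map-∘; map-id-local)
open import Data.List.Membership.Propositional using (_∈_)
open import Data.List.Membership.Propositional.Properties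
  using (∈-map⁺; ∈-map⁻; ∈-++⁺ˡ; ∈-++⁺ʳ; ∈-++⁻)
open import Data.List.Membership.Propositional.Properties.WithK using (unique∧set⇒bag)
open import Data.List.Relation.Binary.BagAndSetEquality using (∼bag⇒↭)
open import Data.List.Relation.Binary.Permutation.Propositional.Properties using (↭-length)
open import Data.List.Relation.Unary.Unique.Propositional using (Unique)
import Data.List.Relation.Unary.Unique.Propositional.Properties as Unique
import Data.List.Relation.Unary.All as All
open import Data.Product using (_×_; _,_; proj₁; proj₂; ∃₂)
open import Data.Sum using (_⊎_; inj₁; inj₂; [_,_]′)
open import Data.Sum.Properties using (inj₁-injective; inj₂-injective)
open import Data.Unit using (tt)
open import Function using (_∘_)
open import Function.Bundles using (_⇔_; mk⇔; Equivalence)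
open import Relation.Nullary using (¬_; yes; no; contradiction)
open import Relation.Binary.PropositionalEquality
  using (_≡_; refl; sym; trans; cong; cong₂; subst; module ≡-Reasoning)

Listing : {A : Set} → (A → Set) → List A → Set
Listing P xs = Unique xs × (∀ x → x ∈ xs ⇔ P x)

module _ {A : Set} {P : A → Set} where

  Listing-length : ∀ {xs ys} → Listing P xs → Listing P ys → length xs ≡ length ys
  Listing-length (uxs , ∈xs) (uys , ∈ys) =
    ↭-length (∼bag⇒↭ (unique∧set⇒bag uxs uys
      (λ {z} → mk⇔ (Equivalence.from (∈ys z) ∘ Equivalence.to (∈xs z))
                   (Equivalence.from (∈xs z) ∘ Equivalence.to (∈ys z)))))

module _ {A B : Set} {P : A → Set} {Q : B → Set} where

  Listing-map : (f : A → B) (g : B → A) →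
    (∀ a → P a → Q (f a) × g (f a) ≡ a) → (∀ b → Q b → P (g b) × f (g b) ≡ b) →
    ∀ {xs} → Listing P xs → Listing Q (map f xs)
  Listing-map f g f-ok g-ok {xs} (uxs , ∈xs) = unique , λ b → mk⇔ (to b) (from b)
    where
    g∘f≡id : map (g ∘ f) xs ≡ xs
    g∘f≡id = map-id-local (All.tabulate λ {a} a∈ → proj₂ (f-ok a (Equivalence.to (∈xs a) a∈)))
    unique : Unique (map f xs)
    unique = Unique.map⁻ {f = g} (subst Unique (trans (sym g∘f≡id) (map-∘ xs)) uxs)
    to : ∀ b → b ∈ map f xs → Q b
    to b b∈ with ∈-map⁻ f b∈
    ... | a , a∈ , refl = proj₁ (f-ok a (Equivalence.to (∈xs a) a∈))
    from : ∀ b → Q b → b ∈ map f xs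
    from b qb = let (pgb , fgb≡b) = g-ok b qb in
      subst (_∈ map f xs) fgb≡b (∈-map⁺ f (Equivalence.from (∈xs (g b)) pgb))

  Listing-⊎ : ∀ {xs ys} → Listing P xs → Listing Q ys →
    Listing [ P , Q ]′ (map inj₁ xs ++ map inj₂ ys)
  Listing-⊎ {xs} {ys} (uxs , ∈xs) (uys , ∈ys) =
    Unique.++⁺ (Unique.map⁺ inj₁-injective uxs) (Unique.map⁺ inj₂-injective uys) disjoint ,
    λ z → mk⇔ (to z) (from z)
    where
    disjoint : ∀ {z} → ¬ (z ∈ map inj₁ xs × z ∈ map inj₂ ys)
    disjoint (z∈₁ , z∈₂) with ∈-map⁻ inj₁ z∈₁ | ∈-map⁻ inj₂ z∈₂
    ... | _ , _ , refl | _ , _ , ()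
    to : ∀ z → z ∈ map inj₁ xs ++ map inj₂ ys → [ P , Q ]′ z
    to z z∈ with ∈-++⁻ (map inj₁ xs) z∈
    ... | inj₁ z∈₁ with ∈-map⁻ inj₁ z∈₁
    ...   | a , a∈ , refl = Equivalence.to (∈xs a) a∈
    to z z∈ | inj₂ z∈₂ with ∈-map⁻ inj₂ z∈₂
    ...   | b , b∈ , refl = Equivalence.to (∈ys b) b∈
    from : ∀ z → [ P , Q ]′ z → z ∈ map inj₁ xs ++ map inj₂ ys
    from (inj₁ a) pa = ∈-++⁺ˡ (∈-map⁺ inj₁ (Equivalence.from (∈xs a) pa))
    from (inj₂ b) qb = ∈-++⁺ʳ (map inj₁ xs) (∈-map⁺ inj₂ (Equivalence.from (∈ys b) qb))

length-map-inj₁-++-map-inj₂ : {A B : Set} (xs : List A) (ys : List B) →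
  length (map inj₁ xs ++ map inj₂ ys) ≡ length xs + length ys
length-map-inj₁-++-map-inj₂ xs ys =
  trans (length-++ (map inj₁ xs)) (cong₂ _+_ (length-map inj₁ xs) (length-map inj₂ ys))

module _ {A : Set} where

  last⁺ : A → List A → A
  last⁺ x [] = x
  last⁺ _ (y ∷ ys) = last⁺ y ys

  init : List A → List A
  init [] = []
  init (_ ∷ []) = []
  init (x ∷ y ∷ ys) = x ∷ init (y ∷ ys)

  last⁺-∷ʳ : ∀ x xs y → last⁺ x (xs ∷ʳ y) ≡ y
  last⁺-∷ʳ x [] y = refl
  last⁺-∷ʳ x (z ∷ xs) y = last⁺-∷ʳ z xs y

  init-∷ʳ : ∀ xs y → init (xs ∷ʳ y) ≡ xs
  init-∷ʳ [] y = refl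
  init-∷ʳ (x ∷ []) y = refl
  init-∷ʳ (x ∷ z ∷ xs) y = cong (x ∷_) (init-∷ʳ (z ∷ xs) y)

  init-∷ʳ-last⁺ : ∀ x xs → init (x ∷ xs) ∷ʳ last⁺ x xs ≡ x ∷ xs
  init-∷ʳ-last⁺ x [] = refl
  init-∷ʳ-last⁺ x (y ∷ xs) = cong (x ∷_) (init-∷ʳ-last⁺ y xs)

  ∷ʳ-is-∷ : ∀ xs y → ∃₂ λ z (zs : List A) → xs ∷ʳ y ≡ z ∷ zs
  ∷ʳ-is-∷ [] y = y , [] , refl
  ∷ʳ-is-∷ (x ∷ xs) y = x , xs ∷ʳ y , refl

odd+even⇒odd : ∀ {a c} → Odd a → Even c → Odd (a + c)
odd+even⇒odd = ∣m∣n⇒∣m+n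

even+odd⇒odd : ∀ {c b} → Even c → Odd b → Odd (c + b)
even+odd⇒odd {c} {b} ec ob = subst Odd (+-comm b c) (odd+even⇒odd ob ec)

odd+odd⇒even : ∀ {a b} → Odd a → Odd b → Even (a + b)
odd+odd⇒even {a} {b} oa ob =
  ∣m+n∣m⇒∣n {m = 2} (subst (2 ∣_) (cong suc (+-suc a b)) (∣m∣n⇒∣m+n oa ob)) ∣-refl

odd∸odd⇒even : ∀ {a b} → Odd a → Odd b → b ≤ a → Even (a ∸ b)
odd∸odd⇒even {a} {b} oa ob b≤a =
  ∣m+n∣m⇒∣n {m = suc b} (subst (2 ∣_) (cong suc (sym (m+[n∸m]≡n b≤a))) oa) ob

odd⇒¬even : ∀ {a} → Odd a → ¬ Even a
odd⇒¬even {a} oa ea with ∣1⇒≡1 (∣m+n∣m⇒∣n {m = a} (subst (2 ∣_) (+-comm 1 a) oa) ea)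
... | ()

Decreasing-∷-mono : ∀ {a a′ k k′ xs} → a ≤ a′ →
  Decreasing ((a , k) ∷ xs) → Decreasing ((a′ , k′) ∷ xs)
Decreasing-∷-mono {xs = []} _ _ = tt
Decreasing-∷-mono {xs = _ ∷ _} a≤a′ (q<a , dec) = <-≤-trans q<a a≤a′ , dec

Decreasing-∷ʳ-mult : ∀ xs {b m m′} → Decreasing (xs ∷ʳ (b , m)) → Decreasing (xs ∷ʳ (b , m′))
Decreasing-∷ʳ-mult [] _ = tt
Decreasing-∷ʳ-mult (_ ∷ []) (b<p , _) = b<p , tt
Decreasing-∷ʳ-mult (_ ∷ q ∷ xs) (q<p , dec) = q<p , Decreasing-∷ʳ-mult (q ∷ xs) dec

Decreasing-∷ʳ⁻ : ∀ p ys {c k} → Decreasing (p ∷ ys ∷ʳ (c , k)) →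
  Decreasing (p ∷ ys) × c < proj₁ (last⁺ p ys)
Decreasing-∷ʳ⁻ p [] (c<p , _) = tt , c<p
Decreasing-∷ʳ⁻ p (q ∷ ys) (q<p , dec) =
  let (dec′ , c<last) = Decreasing-∷ʳ⁻ q ys dec in (q<p , dec′) , c<last

Decreasing-∷ʳ⁺ : ∀ p ys {c k} → Decreasing (p ∷ ys) → c < proj₁ (last⁺ p ys) →
  Decreasing (p ∷ ys ∷ʳ (c , k))
Decreasing-∷ʳ⁺ p [] _ c<p = c<p , tt
Decreasing-∷ʳ⁺ p (q ∷ ys) (q<p , dec) c<last = q<p , Decreasing-∷ʳ⁺ q ys dec c<last

AllPosMult-∷ʳ⁺ : ∀ xs {b m} → AllPosMult xs → 0 < b → 0 < m → AllPosMult (xs ∷ʳ (b , m))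
AllPosMult-∷ʳ⁺ [] _ 0<b 0<m = 0<b , 0<m , tt
AllPosMult-∷ʳ⁺ (_ ∷ xs) (0<a , 0<k , pxs) 0<b 0<m = 0<a , 0<k , AllPosMult-∷ʳ⁺ xs pxs 0<b 0<m

AllPosMult-∷ʳ⁻ : ∀ xs {b m} → AllPosMult (xs ∷ʳ (b , m)) → AllPosMult xs × 0 < b × 0 < m
AllPosMult-∷ʳ⁻ [] (0<b , 0<m , _) = tt , 0<b , 0<m
AllPosMult-∷ʳ⁻ (_ ∷ xs) (0<a , 0<k , p) =
  let (pxs , 0<b , 0<m) = AllPosMult-∷ʳ⁻ xs p in (0<a , 0<k , pxs) , 0<b , 0<m

AllOddParts-∷ʳ⁺ : ∀ xs {b m} → AllOddParts xs → Odd b → AllOddParts (xs ∷ʳ (b , m))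
AllOddParts-∷ʳ⁺ [] _ ob = ob , tt
AllOddParts-∷ʳ⁺ (_ ∷ xs) (oa , oxs) ob = oa , AllOddParts-∷ʳ⁺ xs oxs ob

AllOddParts-∷ʳ⁻ : ∀ xs {b m} → AllOddParts (xs ∷ʳ (b , m)) → AllOddParts xs × Odd b
AllOddParts-∷ʳ⁻ [] (ob , _) = tt , ob
AllOddParts-∷ʳ⁻ (_ ∷ xs) (oa , o) = let (oxs , ob) = AllOddParts-∷ʳ⁻ xs o in (oa , oxs) , ob

size-∷ʳ : ∀ xs a k → size (xs ∷ʳ (a , k)) ≡ size xs + k * a
size-∷ʳ [] a k = +-identityʳ (k * a)
size-∷ʳ ((b , j) ∷ xs) a k = trans (cong (j * b +_) (size-∷ʳ xs a k)) (sym (+-assoc (j * b) _ _))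

merge₀ merge₁ split₁ : List Pair → List Pair
merge₀ [] = []
merge₀ ((l , k) ∷ rest) = let (b , m) = last⁺ (l , k) rest in (l + b , m) ∷ (l , k ∸ m) ∷ init rest
merge₁ [] = []
merge₁ ((c , k) ∷ rest) = let (b , m) = last⁺ (c , k) rest in (c + b , k) ∷ init rest ∷ʳ (b , m ∸ k)
split₁ [] = []
split₁ ((a , k) ∷ rest) = let (b , m) = last⁺ (a , k) rest in (a ∸ b , k) ∷ init rest ∷ʳ (b , m + k)

split₀ : List Pair → List Pair
split₀ ((a₁ , k₁) ∷ (a₂ , k₂) ∷ ys) = (a₂ , k₂ + k₁) ∷ ys ∷ʳ (a₁ ∸ a₂ , k₁)
split₀ xs = xs

merge₀-∷ʳ : ∀ l k mid b m → merge₀ ((l , k) ∷ mid ∷ʳ (b , m)) ≡ (l + b , m) ∷ (l , k ∸ m) ∷ mid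
merge₀-∷ʳ l k mid b m
  rewrite last⁺-∷ʳ (l , k) mid (b , m) | init-∷ʳ mid (b , m) = refl

merge₁-∷ʳ : ∀ c k mid b m → merge₁ ((c , k) ∷ mid ∷ʳ (b , m)) ≡ (c + b , k) ∷ mid ∷ʳ (b , m ∸ k)
merge₁-∷ʳ c k mid b m
  rewrite last⁺-∷ʳ (c , k) mid (b , m) | init-∷ʳ mid (b , m) = refl

split₁-∷ʳ : ∀ a k mid b m → split₁ ((a , k) ∷ mid ∷ʳ (b , m)) ≡ (a ∸ b , k) ∷ mid ∷ʳ (b , m + k)
split₁-∷ʳ a k mid b m
  rewrite last⁺-∷ʳ (a , k) mid (b , m) | init-∷ʳ mid (b , m) = refl

split₀-merge₀ : ∀ l k mid b m → m ≤ k →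
  split₀ (merge₀ ((l , k) ∷ mid ∷ʳ (b , m))) ≡ (l , k) ∷ mid ∷ʳ (b , m)
split₀-merge₀ l k mid b m m≤k =
  trans (cong split₀ (merge₀-∷ʳ l k mid b m))
        (cong₂ (λ k′ b′ → (l , k′) ∷ mid ∷ʳ (b′ , m)) (m∸n+n≡m m≤k) (m+n∸m≡n l b))

merge₀-split₀ : ∀ a₁ k₁ a₂ k₂ ys → a₂ ≤ a₁ →
  merge₀ (split₀ ((a₁ , k₁) ∷ (a₂ , k₂) ∷ ys)) ≡ (a₁ , k₁) ∷ (a₂ , k₂) ∷ ys
merge₀-split₀ a₁ k₁ a₂ k₂ ys a₂≤a₁ =
  trans (merge₀-∷ʳ a₂ (k₂ + k₁) ys (a₁ ∸ a₂) k₁)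
        (cong₂ (λ a k → (a , k₁) ∷ (a₂ , k) ∷ ys) (m+[n∸m]≡n a₂≤a₁) (m+n∸n≡m k₂ k₁))

split₁-merge₁ : ∀ c k mid b m → k ≤ m →
  split₁ (merge₁ ((c , k) ∷ mid ∷ʳ (b , m))) ≡ (c , k) ∷ mid ∷ʳ (b , m)
split₁-merge₁ c k mid b m k≤m =
  trans (cong split₁ (merge₁-∷ʳ c k mid b m))
        (trans (split₁-∷ʳ (c + b) k mid b (m ∸ k))
               (cong₂ (λ c′ m′ → (c′ , k) ∷ mid ∷ʳ (b , m′)) (m+n∸n≡m c b) (m∸n+n≡m k≤m)))

merge₁-split₁ : ∀ a k q ys → proj₁ (last⁺ q ys) ≤ a →
  merge₁ (split₁ ((a , k) ∷ q ∷ ys)) ≡ (a , k) ∷ q ∷ ys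
merge₁-split₁ a k q ys b≤a = begin
  merge₁ ((a ∸ b , k) ∷ mid ∷ʳ (b , m + k))  ≡⟨ merge₁-∷ʳ (a ∸ b) k mid b (m + k) ⟩
  (a ∸ b + b , k) ∷ mid ∷ʳ (b , m + k ∸ k)   ≡⟨ cong₂ (λ a′ m′ → (a′ , k) ∷ mid ∷ʳ (b , m′))
                                                       (m∸n+n≡m b≤a) (m+n∸n≡m m k) ⟩
  (a , k) ∷ mid ∷ʳ last⁺ q ys                ≡⟨ cong ((a , k) ∷_) (init-∷ʳ-last⁺ q ys) ⟩
  (a , k) ∷ q ∷ ys                           ∎
  where
  open ≡-Reasoning
  mid : List Pair
  mid = init (q ∷ ys)
  b m : ℕ
  b = proj₁ (last⁺ q ys)
  m = proj₂ (last⁺ q ys)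

size-merge₀ : ∀ {xs} → InF0 xs → size (merge₀ xs) ≡ size xs
size-merge₀ (_ , l , k , mid , b , m , refl , _ , _ , _ , m<k) = begin
  size (merge₀ ((l , k) ∷ mid ∷ʳ (b , m)))  ≡⟨ cong size (merge₀-∷ʳ l k mid b m) ⟩
  m * (l + b) + ((k ∸ m) * l + size mid)    ≡⟨ identity (k ∸ m) m l b (size mid) ⟩
  (k ∸ m + m) * l + (size mid + m * b)      ≡⟨ cong₂ (λ k′ s → k′ * l + s)
                                                     (m∸n+n≡m (<⇒≤ m<k)) (sym (size-∷ʳ mid b m)) ⟩
  k * l + size (mid ∷ʳ (b , m))             ∎
  where
  open ≡-Reasoning
  identity : ∀ d m l b s → m * (l + b) + (d * l + s) ≡ (d + m) * l + (s + m * b)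
  identity = solve-∀

size-merge₁ : ∀ {xs} → InF1 xs → size (merge₁ xs) ≡ size xs
size-merge₁ (_ , c , k , mid , b , m , refl , _ , _ , _ , k<m) = begin
  size (merge₁ ((c , k) ∷ mid ∷ʳ (b , m)))   ≡⟨ cong size (merge₁-∷ʳ c k mid b m) ⟩
  k * (c + b) + size (mid ∷ʳ (b , m ∸ k))    ≡⟨ cong (k * (c + b) +_) (size-∷ʳ mid b (m ∸ k)) ⟩
  k * (c + b) + (size mid + (m ∸ k) * b)     ≡⟨ identity k c b (size mid) (m ∸ k) ⟩
  k * c + (size mid + (m ∸ k + k) * b)       ≡⟨ cong (λ m′ → k * c + (size mid + m′ * b))
                                                     (m∸n+n≡m (<⇒≤ k<m)) ⟩
  k * c + (size mid + m * b)                 ≡⟨ cong (k * c +_) (sym (size-∷ʳ mid b m)) ⟩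
  k * c + size (mid ∷ʳ (b , m))              ∎
  where
  open ≡-Reasoning
  identity : ∀ k c b s d → k * (c + b) + (s + d * b) ≡ k * c + (s + (d + k) * b)
  identity = solve-∀

-- Enumerates S n and EnumeratesOddDivisors n unfold to Listing (OfSize S n) and
-- Listing (OddDivisor n).
OfSize : (List Pair → Set) → ℕ → List Pair → Set
OfSize P n xs = P xs × size xs ≡ n

OddDivisor : ℕ → ℕ → Set
OddDivisor n d = 0 < d × d ∣ n × Odd d

RHS : Set
RHS = ℕ ⊎ (List Pair ⊎ List Pair)

InRHS : ℕ → RHS → Set
InRHS n = [ OddDivisor n , [ OfSize InF0 n , OfSize InF1 n ]′ ]′

toOdd : ℕ → RHS → List Pair
toOdd n (inj₁ zero) = []
toOdd n (inj₁ (suc d)) = (suc d , n / suc d) ∷ []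
toOdd n (inj₂ (inj₁ xs)) = merge₀ xs
toOdd n (inj₂ (inj₂ xs)) = merge₁ xs

fromOdd : List Pair → RHS
fromOdd [] = inj₁ 0
fromOdd ((a , _) ∷ []) = inj₁ a
fromOdd xs@((a₁ , _) ∷ (a₂ , k₂) ∷ ys) with a₁ <? a₂ + proj₁ (last⁺ (a₂ , k₂) ys)
... | yes _ = inj₂ (inj₁ (split₀ xs))
... | no _ = inj₂ (inj₂ (split₁ xs))

fromOdd-< : ∀ {x a₁ k₁ q ys} → x ≡ (a₁ , k₁) ∷ q ∷ ys →
  a₁ < proj₁ q + proj₁ (last⁺ q ys) → fromOdd x ≡ inj₂ (inj₁ (split₀ x))
fromOdd-< {a₁ = a₁} {q = q} {ys} refl h with a₁ <? proj₁ q + proj₁ (last⁺ q ys)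
... | yes _ = refl
... | no ¬h = contradiction h ¬h

fromOdd-≮ : ∀ {x a₁ k₁ q ys} → x ≡ (a₁ , k₁) ∷ q ∷ ys →
  ¬ a₁ < proj₁ q + proj₁ (last⁺ q ys) → fromOdd x ≡ inj₂ (inj₂ (split₁ x))
fromOdd-≮ {a₁ = a₁} {q = q} {ys} refl ¬h with a₁ <? proj₁ q + proj₁ (last⁺ q ys)
... | yes h = contradiction h ¬h
... | no _ = refl

merge₀-InO : ∀ {xs} → InF0 xs → InO (merge₀ xs)
merge₀-InO ((dec , 0<l , _ , p) , l , k , mid , b , m , refl , ol , omid , eb , m<k)
  with AllPosMult-∷ʳ⁻ mid p
... | pmid , 0<b , 0<m = subst InO (sym (merge₀-∷ʳ l k mid b m))
  (((m<m+n l 0<b , proj₁ (Decreasing-∷ʳ⁻ (l , k ∸ m) mid (Decreasing-∷-mono ≤-refl dec))) ,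
    <-≤-trans 0<l (m≤m+n l b) , 0<m , 0<l , m<n⇒0<n∸m m<k , pmid) ,
   odd+even⇒odd ol eb , ol , omid)

fromOdd-merge₀ : ∀ {xs} → InF0 xs → fromOdd (merge₀ xs) ≡ inj₂ (inj₁ xs)
fromOdd-merge₀ ((dec , _) , l , k , mid , b , m , refl , _ , _ , _ , m<k) =
  trans (fromOdd-< (merge₀-∷ʳ l k mid b m) (+-monoʳ-< l b<last))
        (cong (inj₂ ∘ inj₁) (split₀-merge₀ l k mid b m (<⇒≤ m<k)))
  where
  b<last : b < proj₁ (last⁺ (l , k ∸ m) mid)
  b<last = proj₂ (Decreasing-∷ʳ⁻ (l , k ∸ m) mid (Decreasing-∷-mono ≤-refl dec))

merge₁-InO : ∀ {xs} → InF1 xs → InO (merge₁ xs)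
merge₁-InO ((dec , 0<c , 0<k , p) , c , k , mid , b , m , refl , ec , omid , ob , k<m)
  with AllPosMult-∷ʳ⁻ mid p
... | pmid , 0<b , _ = subst InO (sym (merge₁-∷ʳ c k mid b m))
  ((Decreasing-∷ʳ-mult ((c + b , k) ∷ mid) (Decreasing-∷-mono (m≤m+n c b) dec) ,
    <-≤-trans 0<c (m≤m+n c b) , 0<k , AllPosMult-∷ʳ⁺ mid pmid 0<b (m<n⇒0<n∸m k<m)) ,
   even+odd⇒odd ec ob , AllOddParts-∷ʳ⁺ mid omid ob)

fromOdd-merge₁ : ∀ {xs} → InF1 xs → fromOdd (merge₁ xs) ≡ inj₂ (inj₂ xs)
fromOdd-merge₁ ((dec , _) , c , k , mid , b , m , refl , _ , _ , _ , k<m)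
  with ∷ʳ-is-∷ mid (b , m ∸ k)
... | q , ys , mid∷ʳ≡q∷ys =
  trans (fromOdd-≮ merge₁xs≡ ¬<) (cong (inj₂ ∘ inj₂) (split₁-merge₁ c k mid b m (<⇒≤ k<m)))
  where
  merge₁xs≡ : merge₁ ((c , k) ∷ mid ∷ʳ (b , m)) ≡ (c + b , k) ∷ q ∷ ys
  merge₁xs≡ = trans (merge₁-∷ʳ c k mid b m) (cong ((c + b , k) ∷_) mid∷ʳ≡q∷ys)
  last≡b : proj₁ (last⁺ q ys) ≡ b
  last≡b = cong proj₁ (trans (cong (last⁺ (c , k)) (sym mid∷ʳ≡q∷ys))
                             (last⁺-∷ʳ (c , k) mid (b , m ∸ k)))
  q<c : proj₁ q < c
  q<c = proj₁ (subst (λ r → Decreasing ((c , k) ∷ r)) mid∷ʳ≡q∷ys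
                     (Decreasing-∷ʳ-mult ((c , k) ∷ mid) dec))
  ¬< : ¬ c + b < proj₁ q + proj₁ (last⁺ q ys)
  ¬< h = <-asym (subst (λ b′ → c + b < proj₁ q + b′) last≡b h) (+-monoˡ-< b q<c)

split₀-InF0 : ∀ a₁ k₁ a₂ k₂ ys → InO ((a₁ , k₁) ∷ (a₂ , k₂) ∷ ys) →
  a₁ < a₂ + proj₁ (last⁺ (a₂ , k₂) ys) → InF0 (split₀ ((a₁ , k₁) ∷ (a₂ , k₂) ∷ ys))
split₀-InF0 a₁ k₁ a₂ k₂ ys (((a₂<a₁ , dec) , _ , 0<k₁ , 0<a₂ , 0<k₂ , pys) , oa₁ , oa₂ , oys)
  a₁<a₂+b =
  (Decreasing-∷-mono ≤-refl (Decreasing-∷ʳ⁺ (a₂ , k₂) ys dec a₁∸a₂<b) ,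
   0<a₂ , <-≤-trans 0<k₂ (m≤m+n k₂ k₁) , AllPosMult-∷ʳ⁺ ys pys (m<n⇒0<n∸m a₂<a₁) 0<k₁) ,
  a₂ , k₂ + k₁ , ys , a₁ ∸ a₂ , k₁ , refl ,
  oa₂ , oys , odd∸odd⇒even oa₁ oa₂ (<⇒≤ a₂<a₁) , m<n+m k₁ 0<k₂
  where
  b : ℕ
  b = proj₁ (last⁺ (a₂ , k₂) ys)
  a₁∸a₂<b : a₁ ∸ a₂ < b
  a₁∸a₂<b = subst (_≤ b) (+-∸-assoc 1 (<⇒≤ a₂<a₁)) (m≤n+o⇒m∸n≤o (suc a₁) a₂ a₁<a₂+b)

split₁-InF1 : ∀ a₁ k₁ q ys → InO ((a₁ , k₁) ∷ q ∷ ys) →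
  ¬ a₁ < proj₁ q + proj₁ (last⁺ q ys) → InF1 (split₁ ((a₁ , k₁) ∷ q ∷ ys))
split₁-InF1 a₁ k₁ q ys (((q<a₁ , dec) , _ , 0<k₁ , pq) , oa₁ , oq) a₁≮
  with AllPosMult-∷ʳ⁻ (init (q ∷ ys)) (subst AllPosMult (sym (init-∷ʳ-last⁺ q ys)) pq)
     | AllOddParts-∷ʳ⁻ (init (q ∷ ys)) (subst AllOddParts (sym (init-∷ʳ-last⁺ q ys)) oq)
... | pmid , 0<b , 0<m | omid , ob =
  (Decreasing-∷ʳ-mult ((a₁ ∸ b , k₁) ∷ mid)
     (subst (λ r → Decreasing ((a₁ ∸ b , k₁) ∷ r)) (sym (init-∷ʳ-last⁺ q ys)) (q<a₁∸b , dec)) ,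
   m<n⇒0<n∸m b<a₁ , 0<k₁ , AllPosMult-∷ʳ⁺ mid pmid 0<b (<-≤-trans 0<m (m≤m+n m k₁))) ,
  a₁ ∸ b , k₁ , mid , b , m + k₁ , refl ,
  odd∸odd⇒even oa₁ ob (<⇒≤ b<a₁) , omid , ob , m<n+m k₁ 0<m
  where
  mid : List Pair
  mid = init (q ∷ ys)
  b m : ℕ
  b = proj₁ (last⁺ q ys)
  m = proj₂ (last⁺ q ys)
  q+b<a₁ : proj₁ q + b < a₁
  q+b<a₁ = ≤∧≢⇒< (≮⇒≥ a₁≮) λ q+b≡a₁ →
    odd⇒¬even oa₁ (subst Even q+b≡a₁ (odd+odd⇒even (proj₁ oq) ob))
  b<a₁ : b < a₁
  b<a₁ = ≤-<-trans (m≤n+m b (proj₁ q)) q+b<a₁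
  q<a₁∸b : proj₁ q < a₁ ∸ b
  q<a₁∸b = m+n≤o⇒m≤o∸n (suc (proj₁ q)) q+b<a₁

/-exact : ∀ {n} q d → n ≡ q * suc d → n / suc d ≡ q
/-exact q d n≡q*d = trans (cong (_/ suc d) n≡q*d) (m*n/n≡m q (suc d))

divisor-toOdd : ∀ {n d} → 0 < n → OddDivisor n d →
  OfSize InO n (toOdd n (inj₁ d)) × fromOdd (toOdd n (inj₁ d)) ≡ inj₁ d
divisor-toOdd {n} {suc d} 0<n (0<d , divides q n≡q*d , od) =
  (((tt , 0<d , subst (0 <_) (sym (/-exact q d n≡q*d)) 0<q , tt) , od , tt) , size≡) , refl
  where
  0<q : 0 < q
  0<q = n≢0⇒n>0 λ q≡0 → >⇒≢ 0<n (trans n≡q*d (cong (_* suc d) q≡0))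
  size≡ : n / suc d * suc d + 0 ≡ n
  size≡ = trans (+-identityʳ _) (trans (cong (_* suc d) (/-exact q d n≡q*d)) (sym n≡q*d))

divisor-fromOdd : ∀ {n a k} → OfSize InO n ((a , k) ∷ []) →
  OddDivisor n a × toOdd n (inj₁ a) ≡ (a , k) ∷ []
divisor-fromOdd {n} {suc a} {k} (((_ , 0<a , _) , oa , _) , size≡) =
  (0<a , divides k (sym k*a≡n) , oa) , cong (λ j → (suc a , j) ∷ []) (/-exact k a (sym k*a≡n))
  where
  k*a≡n : k * suc a ≡ n
  k*a≡n = trans (sym (+-identityʳ _)) size≡

toOdd-correct : ∀ {n} → 0 < n → ∀ c → InRHS n c →
  OfSize InO n (toOdd n c) × fromOdd (toOdd n c) ≡ c
toOdd-correct 0<n (inj₁ d) odd-d = divisor-toOdd 0<n odd-d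
toOdd-correct _ (inj₂ (inj₁ xs)) (F0 , size≡) =
  (merge₀-InO F0 , trans (size-merge₀ F0) size≡) , fromOdd-merge₀ F0
toOdd-correct _ (inj₂ (inj₂ xs)) (F1 , size≡) =
  (merge₁-InO F1 , trans (size-merge₁ F1) size≡) , fromOdd-merge₁ F1

fromOdd-correct : ∀ {n} x → OfSize InO n x → InRHS n (fromOdd x) × toOdd n (fromOdd x) ≡ x
fromOdd-correct [] ((() , _) , _)
fromOdd-correct (_ ∷ []) O = divisor-fromOdd O
fromOdd-correct ((a₁ , k₁) ∷ (a₂ , k₂) ∷ ys) (O , size≡)
  with a₁ <? a₂ + proj₁ (last⁺ (a₂ , k₂) ys)
... | yes h = (F0 , trans (sym (size-merge₀ F0)) (trans (cong size inverse) size≡)) , inverse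
  where
  F0 : InF0 (split₀ ((a₁ , k₁) ∷ (a₂ , k₂) ∷ ys))
  F0 = split₀-InF0 a₁ k₁ a₂ k₂ ys O h
  inverse : merge₀ (split₀ ((a₁ , k₁) ∷ (a₂ , k₂) ∷ ys)) ≡ (a₁ , k₁) ∷ (a₂ , k₂) ∷ ys
  inverse = merge₀-split₀ a₁ k₁ a₂ k₂ ys (<⇒≤ (proj₁ (proj₁ (proj₁ O))))
... | no ¬h = (F1 , trans (sym (size-merge₁ F1)) (trans (cong size inverse) size≡)) , inverse
  where
  F1 : InF1 (split₁ ((a₁ , k₁) ∷ (a₂ , k₂) ∷ ys))
  F1 = split₁-InF1 a₁ k₁ (a₂ , k₂) ys O ¬h
  inverse : merge₁ (split₁ ((a₁ , k₁) ∷ (a₂ , k₂) ∷ ys)) ≡ (a₁ , k₁) ∷ (a₂ , k₂) ∷ ys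
  inverse = merge₁-split₁ a₁ k₁ (a₂ , k₂) ys (≤-trans (m≤n+m _ a₂) (≮⇒≥ ¬h))

mainTheorem12 : (n : ℕ) → 0 < n →
    (LO LF0 LF1 : List (List Pair)) (D : List ℕ) →
    Enumerates InO n LO → Enumerates InF0 n LF0 → Enumerates InF1 n LF1 →
    EnumeratesOddDivisors n D →
    length LO ≡ length D + length LF0 + length LF1
mainTheorem12 n 0<n LO LF0 LF1 D listO listF0 listF1 listD = begin
  length LO                                    ≡⟨ Listing-length listO listO′ ⟩
  length (map (toOdd n) rhs)                   ≡⟨ length-map (toOdd n) rhs ⟩
  length rhs                                   ≡⟨ length-map-inj₁-++-map-inj₂ D _ ⟩
  length D + length (map inj₁ LF0 ++ map inj₂ LF1)
    ≡⟨ cong (length D +_) (length-map-inj₁-++-map-inj₂ LF0 LF1) ⟩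
  length D + (length LF0 + length LF1)         ≡⟨ sym (+-assoc (length D) _ _) ⟩
  length D + length LF0 + length LF1           ∎
  where
  open ≡-Reasoning
  rhs : List RHS
  rhs = map inj₁ D ++ map inj₂ (map inj₁ LF0 ++ map inj₂ LF1)
  listRHS : Listing (InRHS n) rhs
  listRHS = Listing-⊎ listD (Listing-⊎ listF0 listF1)
  listO′ : Listing (OfSize InO n) (map (toOdd n) rhs)
  listO′ = Listing-map (toOdd n) fromOdd (toOdd-correct 0<n) fromOdd-correct listRHS
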